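{- Let $N\ge 0$, $k\ge 1$, let $X=\{0,1,\ldots,N\}^k$ be ordered componentwise by $\leq_k$, and let $f: X\to\{\mathbf{true},\mathbf{false}\}$ be a feasibility function. Let $\vec x\in X$ with $f(\vec x)=\mathbf{true}$. Then the procedure $\textsc{SearchParetoPoint}(\vec x,k,f)$ returns a Pareto point $\vec z$ of $f$ with $\vec z\leq_k \vec x$.
   Context: For $\vec x=(x_1,\ldots,x_k),\vec x'=(x'_1,\ldots,x'_k)\in X$, $\vec x\leq_k \vec x'$ means $x_i\le x'_i$ for all $i$. A feasibility function is a function $f:X\to\{\mathbf{true},\mathbf{false}\}$ that is monotone: if $f(\vec x)=\mathbf{true}$ and $\vec x\leq_k\vec x'$ then $f(\vec x')=\mathbf{true}$. A point $\vec x$ is a Pareto point (Pareto-optimal) if $f(\vec x)=\mathbf{true}$ and $f(\vec x')=\mathbf{false}$ for every $\vec x'\neq\vec x$ with $\vec x'\leq_k\vec x$. The procedure $\textsc{SearchParetoPoint}(\vec x,k,f)$: for $i=1,\ldots,k$ in order: set $\mathit{max}\gets x_i+1$, $\mathit{min}\gets 0$; while $\mathit{max}-\mathit{min}>1$: set $\mathit{mid}\gets \mathit{min}+\lfloor(\mathit{max}-\mathit{min}-1)/2\rfloor$, set $x_i\gets\mathit{mid}$, and if $f(\vec x)=\mathbf{true}$ then $\mathit{max}\gets\mathit{mid}+1$, else $\mathit{min}\gets\mathit{mid}+1$; after the while loop set $x_i\gets\mathit{min}$. After all $k$ coordinates have been processed, return the current $\vec x$. -}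

module Defs where

open import Data.Nat using (ℕ; zero; suc; _+_; _∸_; _≤_; _<_; _/_)
open import Data.Nat.Properties using (_≤?_)
open import Data.Bool using (Bool; true; false; if_then_else_)
open import Data.Fin using (Fin; zero; suc)
open import Data.Vec using (Vec; lookup; updateAt; _[_]≔_)
open import Data.Vec.Relation.Unary.All using (All)
open import Data.Product using (_×_)
open import Data.List using (List; []; _∷_; allFin)
open import Relation.Nullary using (yes; no)
open import Relation.Binary.PropositionalEquality using (_≡_; _≢_)

InX : (N k : ℕ) → Vec ℕ k → Set
InX N k v = All (_≤ N) v

_≤ₖ_ : {k : ℕ} → Vec ℕ k → Vec ℕ k → Set
_≤ₖ_ {k} x x' = (i : Fin k) → lookup x i ≤ lookup x' i

-- f is a feasibility function on X (monotone w.r.t. ≤ₖ on X).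
-- f is given on all of Vec ℕ k, but only its values on X matter.
IsFeasibility : (N k : ℕ) → (Vec ℕ k → Bool) → Set
IsFeasibility N k f =
  (x x' : Vec ℕ k) → InX N k x → InX N k x' →
  f x ≡ true → x ≤ₖ x' → f x' ≡ true

IsPareto : (N k : ℕ) → (Vec ℕ k → Bool) → Vec ℕ k → Set
IsPareto N k f x =
  InX N k x × f x ≡ true ×
  ((x' : Vec ℕ k) → InX N k x' → x' ≢ x → x' ≤ₖ x → f x' ≡ false)

-- Fuel bounds the number of iterations; each iteration strictly decreases
-- max - min, so fuel = x_i + 1 (≥ initial max - min) suffices.
searchLoop : {k : ℕ} → (Vec ℕ k → Bool) → Vec ℕ k → Fin k →
             (fuel mn mx : ℕ) → ℕ
searchLoop f x i zero mn mx = mn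
searchLoop f x i (suc fuel) mn mx with mx ∸ mn ≤? 1
... | yes _ = mn
... | no _ =
  let mid = mn + ((mx ∸ mn ∸ 1) / 2) in
  if f (x [ i ]≔ mid)
    then searchLoop f (x [ i ]≔ mid) i fuel mn (suc mid)
    else searchLoop f (x [ i ]≔ mid) i fuel (suc mid) mx

processCoord : {k : ℕ} → (Vec ℕ k → Bool) → Vec ℕ k → Fin k → Vec ℕ k
processCoord f x i = x [ i ]≔ searchLoop f x i (suc (lookup x i)) 0 (suc (lookup x i))

processAll : {k : ℕ} → (Vec ℕ k → Bool) → Vec ℕ k → List (Fin k) → Vec ℕ k
processAll f x [] = x
processAll f x (i ∷ is) = processAll f (processCoord f x i) is

searchParetoPoint : (k : ℕ) → (Vec ℕ k → Bool) → Vec ℕ k → Vec ℕ k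
searchParetoPoint k f x = processAll f x (allFin k)

-- The inner loop on coordinate i is a binary search for the least value of
-- the i-th entry keeping the point feasible.  We show that, started on an
-- interval [mn, hi] whose upper end is feasible and whose lower end has an
-- infeasible predecessor, it returns such a "threshold" m ≤ hi
-- (searchLoop-threshold); the loop only reads coordinate i of its vector,
-- which lets the induction ignore the intermediate overwrites
-- (searchLoop-reset).
--
-- Its invariant is that the
-- current point is feasible and below the start point; in addition a
-- coordinate j is "tight" when every point of X below the current one that is
-- strictly smaller in coordinate j is infeasible.  Processing coordinate i
-- makes i tight (by monotonicity of f and the threshold property) and keeps
-- all tight coordinates tight, since it only lowers coordinate i.  After all
-- coordinates are processed every coordinate is tight, and a feasible point
-- with all coordinates tight is a Pareto point: any other point below it is
-- strictly smaller in some coordinate.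
module Submission where

open import Defs
open import Data.Nat using (ℕ; _≥_; zero; suc; _+_; _∸_; _≤_; _<_; _/_; z≤n; s≤s)
open import Data.Nat.Properties
open import Data.Nat.DivMod using (m/n<m)
open import Data.Bool using (Bool; true; false)
open import Data.Unit using (⊤; tt)
open import Data.Vec using (Vec; lookup; _[_]≔_)
open import Data.Vec.Properties using ([]≔-idempotent; []≔-lookup; lookup∘update; lookup∘update′)
open import Data.Vec.Relation.Unary.All.Properties using (lookup⁺; lookup⁻)
open import Data.Vec.Relation.Binary.Pointwise.Extensional using (ext; Pointwise-≡⇒≡)
open import Data.Fin using (Fin)
import Data.Fin.Properties as Fin
open import Data.List using ([]; _∷_; allFin)
open import Data.List.Membership.Propositional using (_∈_)
open import Data.List.Membership.Propositional.Properties using (∈-allFin)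
open import Data.List.Relation.Unary.Any using (here; there)
open import Data.Product using (_×_; _,_; ∃; proj₁; proj₂)
open import Relation.Nullary using (yes; no; ¬_; contradiction)
open import Relation.Binary.PropositionalEquality

midpoint : ℕ → ℕ → ℕ
midpoint mn mx = mn + (mx ∸ mn ∸ 1) / 2

-- The inner loop only ever reads the vector through coordinate i, so first
-- overwriting that coordinate does not change its outcome.
searchLoop-reset : ∀ {k} (f : Vec ℕ k → Bool) (x : Vec ℕ k) (i : Fin k) (v fuel mn mx : ℕ) →
                   searchLoop f (x [ i ]≔ v) i fuel mn mx ≡ searchLoop f x i fuel mn mx
searchLoop-reset f x i v zero mn mx = refl
searchLoop-reset f x i v (suc fuel) mn mx with mx ∸ mn ≤? 1
... | yes _ = refl
... | no _ rewrite []≔-idempotent {x = v} {y = midpoint mn mx} x i = refl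

probe : ∀ {k} → (Vec ℕ k → Bool) → Vec ℕ k → Fin k → ℕ → Bool
probe f x i p = f (x [ i ]≔ p)

PredFalse : (ℕ → Bool) → ℕ → Set
PredFalse g zero    = ⊤
PredFalse g (suc p) = g p ≡ false

IsThreshold : (ℕ → Bool) → ℕ → ℕ → Set
IsThreshold g hi m = g m ≡ true × PredFalse g m × m ≤ hi

threshold-weaken : ∀ {g lo hi m} → lo ≤ hi → IsThreshold g lo m → IsThreshold g hi m
threshold-weaken lo≤hi (gm , pred , m≤lo) = gm , pred , ≤-trans m≤lo lo≤hi

half< : ∀ n → 0 < n → n / 2 < n
half< (suc n) _ = m/n<m (suc n) 2 (s≤s (s≤s z≤n))

-- When the search interval [mn, hi] has at least two points, the probed
-- midpoint lies in [mn, hi); so both halves are strictly smaller intervals.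
midpoint-bounds : ∀ {mn hi} → mn < hi → mn ≤ midpoint mn (suc hi) × midpoint mn (suc hi) < hi
midpoint-bounds {mn} {hi} mn<hi rewrite +-∸-assoc 1 (<⇒≤ mn<hi) =
  m≤m+n mn _ , (begin-strict
    mn + (hi ∸ mn) / 2  <⟨ +-monoʳ-< mn (half< (hi ∸ mn) (m<n⇒0<n∸m mn<hi)) ⟩
    mn + (hi ∸ mn)      ≡⟨ m+[n∸m]≡n (<⇒≤ mn<hi) ⟩
    hi                  ∎)
  where open ≤-Reasoning

-- The loop's stopping test (max - min ≤ 1, with max = hi + 1) succeeds
-- exactly when the search interval [mn, hi] is a single point.
stop⇒single : ∀ {mn hi} → mn ≤ hi → suc hi ∸ mn ≤ 1 → mn ≡ hi
stop⇒single mn≤hi stop =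
  ≤-antisym mn≤hi (m∸n≡0⇒m≤n (n≤0⇒n≡0 (≤-pred (subst (_≤ 1) (+-∸-assoc 1 mn≤hi) stop))))

continue⇒wide : ∀ {mn hi} → mn ≤ hi → ¬ (suc hi ∸ mn ≤ 1) → mn < hi
continue⇒wide {mn} mn≤hi continue =
  ≤∧≢⇒< mn≤hi (λ { refl → continue (≤-reflexive (m+n∸n≡m 1 mn)) })

searchLoop-threshold : ∀ {k} (f : Vec ℕ k → Bool) (x : Vec ℕ k) (i : Fin k) →
  ∀ fuel mn hi → hi ∸ mn < fuel → mn ≤ hi →
  probe f x i hi ≡ true → PredFalse (probe f x i) mn →
  IsThreshold (probe f x i) hi (searchLoop f x i fuel mn (suc hi))
searchLoop-threshold f x i zero mn hi () mn≤hi top bottom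
searchLoop-threshold f x i (suc fuel) mn hi room mn≤hi top bottom with suc hi ∸ mn ≤? 1
... | yes stop = subst (λ m → probe f x i m ≡ true) (sym (stop⇒single mn≤hi stop)) top , bottom , mn≤hi
... | no continue with midpoint-bounds (continue⇒wide mn≤hi continue)
... | mn≤mid , mid<hi with probe f x i (midpoint mn (suc hi)) in probe-mid
-- feasible midpoint: continue on [mn, mid]
... | true = subst (IsThreshold (probe f x i) hi) (sym (searchLoop-reset f x i mid fuel mn (suc mid)))
  (threshold-weaken (<⇒≤ mid<hi) (searchLoop-threshold f x i fuel mn mid lower-room mn≤mid probe-mid bottom))
  where
  mid : ℕ
  mid = midpoint mn (suc hi)
  lower-room : mid ∸ mn < fuel
  lower-room = <-≤-trans (∸-monoˡ-< mid<hi mn≤mid) (≤-pred room)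
-- infeasible midpoint: continue on [mid + 1, hi]
... | false = subst (IsThreshold (probe f x i) hi) (sym (searchLoop-reset f x i mid fuel (suc mid) (suc hi)))
  (searchLoop-threshold f x i fuel (suc mid) hi upper-room mid<hi top probe-mid)
  where
  mid : ℕ
  mid = midpoint mn (suc hi)
  upper-room : hi ∸ suc mid < fuel
  upper-room = <-≤-trans (∸-monoʳ-< (s≤s mn≤mid) mid<hi) (≤-pred room)

-- Processing coordinate i of a feasible x replaces x_i by a threshold of the
-- probe below x_i: the initial interval is [0, x_i] and x_i itself is feasible.
processCoord-threshold : ∀ {k} (f : Vec ℕ k → Bool) (x : Vec ℕ k) (i : Fin k) → f x ≡ true →
  IsThreshold (probe f x i) (lookup x i) (searchLoop f x i (suc (lookup x i)) 0 (suc (lookup x i)))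
processCoord-threshold f x i fx =
  searchLoop-threshold f x i (suc (lookup x i)) 0 (lookup x i) ≤-refl z≤n
    (trans (cong f ([]≔-lookup x i)) fx) tt

≤ₖ-refl : ∀ {k} {x : Vec ℕ k} → x ≤ₖ x
≤ₖ-refl i = ≤-refl

≤ₖ-trans : ∀ {k} {x y z : Vec ℕ k} → x ≤ₖ y → y ≤ₖ z → x ≤ₖ z
≤ₖ-trans x≤y y≤z i = ≤-trans (x≤y i) (y≤z i)

≤ₖ-update : ∀ {k} {w y : Vec ℕ k} (i : Fin k) {b : ℕ} →
  (∀ j → j ≢ i → lookup w j ≤ lookup y j) → lookup w i ≤ b → w ≤ₖ (y [ i ]≔ b)
≤ₖ-update {w = w} {y} i {b} off at j with j Fin.≟ i
... | yes refl = subst (lookup w j ≤_) (sym (lookup∘update i y b)) at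
... | no j≢i = subst (lookup w j ≤_) (sym (lookup∘update′ j≢i y b)) (off j j≢i)

update-≤ₖ : ∀ {k} (y : Vec ℕ k) (i : Fin k) {b : ℕ} → b ≤ lookup y i → (y [ i ]≔ b) ≤ₖ y
update-≤ₖ y i {b} b≤yi = subst ((y [ i ]≔ b) ≤ₖ_) ([]≔-lookup y i)
  (≤ₖ-update {w = y [ i ]≔ b} {y} i (λ j j≢i → ≤-reflexive (lookup∘update′ j≢i y b))
                                  (≤-trans (≤-reflexive (lookup∘update i y b)) b≤yi))

strictly-below : ∀ {k} {w y : Vec ℕ k} → w ≤ₖ y → w ≢ y → ∃ λ j → lookup w j < lookup y j
strictly-below {k} {w} {y} w≤y w≢y with Fin.all? (λ j → lookup w j ≟ lookup y j)
... | yes same = contradiction (Pointwise-≡⇒≡ (ext same)) w≢y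
... | no differ with Fin.¬∀⟶∃¬ k _ (λ j → lookup w j ≟ lookup y j) differ
... | j , wj≢yj = j , ≤∧≢⇒< (w≤y j) wj≢yj

InX-downward : ∀ {N k} {w y : Vec ℕ k} → InX N k y → w ≤ₖ y → InX N k w
InX-downward y∈X w≤y = lookup⁻ (λ j → ≤-trans (w≤y j) (lookup⁺ y∈X j))

infeasible-downward : ∀ {N k f} → IsFeasibility N k f → ∀ {w v} → InX N k w → InX N k v →
                      w ≤ₖ v → f v ≡ false → f w ≡ false
infeasible-downward {f = f} feasible {w} {v} w∈X v∈X w≤v fv with f w in fw
... | false = refl
... | true = trans (sym (feasible w v w∈X v∈X fw w≤v)) fv

module Descent {N k : ℕ} {f : Vec ℕ k → Bool} (feasible : IsFeasibility N k f)
               {x₀ : Vec ℕ k} (x₀∈X : InX N k x₀) where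

  Admissible : Vec ℕ k → Set
  Admissible y = f y ≡ true × y ≤ₖ x₀

  Tight : Vec ℕ k → Fin k → Set
  Tight y j = ∀ w → InX N k w → w ≤ₖ y → lookup w j < lookup y j → f w ≡ false

  below-x₀-in-X : ∀ {y} → y ≤ₖ x₀ → InX N k y
  below-x₀-in-X = InX-downward x₀∈X

  tight-inherited : ∀ {y y' j} → y' ≤ₖ y → lookup y' j ≡ lookup y j → Tight y j → Tight y' j
  tight-inherited {y} {y'} {j} y'≤y same tight w w∈X w≤y' w<y' =
    tight w w∈X (≤ₖ-trans {x = w} {y'} {y} w≤y' y'≤y) (subst (lookup w j <_) same w<y')

  threshold-tight : ∀ {y i m} → Admissible y → PredFalse (probe f y i) m → m ≤ lookup y i →
                    Tight (y [ i ]≔ m) i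
  threshold-tight {y} {i} {zero} _ _ _ w _ _ w<0 =
    contradiction (subst (lookup w i <_) (lookup∘update i y 0) w<0) n≮0
  threshold-tight {y} {i} {suc p} (_ , y≤x₀) p-infeasible m≤yi w w∈X w≤y' w<m =
    infeasible-downward feasible w∈X lowered∈X w≤lowered p-infeasible
    where
    lowered≤y : (y [ i ]≔ p) ≤ₖ y
    lowered≤y = update-≤ₖ y i (≤-trans (n≤1+n p) m≤yi)
    lowered∈X : InX N k (y [ i ]≔ p)
    lowered∈X = below-x₀-in-X (≤ₖ-trans {x = y [ i ]≔ p} {y} {x₀} lowered≤y y≤x₀)
    w≤lowered : w ≤ₖ (y [ i ]≔ p)
    w≤lowered = ≤ₖ-update {w = w} {y} i
      (λ j j≢i → ≤-trans (w≤y' j) (≤-reflexive (lookup∘update′ j≢i y (suc p))))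
      (≤-pred (subst (lookup w i <_) (lookup∘update i y (suc p)) w<m))

  processCoord-step : ∀ {y i} → Admissible y →
    Admissible (processCoord f y i) × Tight (processCoord f y i) i ×
    (∀ j → Tight y j → Tight (processCoord f y i) j)
  processCoord-step {y} {i} (fy , y≤x₀) with processCoord-threshold f y i fy
  ... | fy' , pred-infeasible , m≤yi =
    (fy' , ≤ₖ-trans {x = processCoord f y i} {y} {x₀} y'≤y y≤x₀) , tight-i , keep
    where
    y'≤y : processCoord f y i ≤ₖ y
    y'≤y = update-≤ₖ y i m≤yi
    tight-i : Tight (processCoord f y i) i
    tight-i = threshold-tight (fy , y≤x₀) pred-infeasible m≤yi
    keep : ∀ j → Tight y j → Tight (processCoord f y i) j
    keep j tight with j Fin.≟ i
    ... | yes refl = tight-i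
    ... | no j≢i = tight-inherited {y} {processCoord f y i} y'≤y (lookup∘update′ j≢i y _) tight

  processAll-spec : ∀ is y → Admissible y →
    Admissible (processAll f y is) ×
    (∀ j → Tight y j → Tight (processAll f y is) j) ×
    (∀ j → j ∈ is → Tight (processAll f y is) j)
  processAll-spec [] y adm = adm , (λ j tight → tight) , λ j ()
  processAll-spec (i ∷ is) y adm with processCoord-step {y} {i} adm
  ... | adm' , tight-i , keep with processAll-spec is (processCoord f y i) adm'
  ... | adm'' , keep' , tight-is = adm'' , (λ j tight → keep' j (keep j tight)) , processed
    where
    processed : ∀ j → j ∈ i ∷ is → Tight (processAll f (processCoord f y i) is) j
    processed j (here refl) = keep' i tight-i
    processed j (there j∈is) = tight-is j j∈is

  all-tight-pareto : ∀ {z} → Admissible z → (∀ j → Tight z j) → IsPareto N k f z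
  all-tight-pareto {z} (fz , z≤x₀) tight = below-x₀-in-X z≤x₀ , fz , infeasible-below
    where
    infeasible-below : ∀ w → InX N k w → w ≢ z → w ≤ₖ z → f w ≡ false
    infeasible-below w w∈X w≢z w≤z with strictly-below w≤z w≢z
    ... | j , w<z = tight j w w∈X w≤z w<z

lemma1 : (N k : ℕ) → k ≥ 1 → (f : Vec ℕ k → Bool) → IsFeasibility N k f →
         (x : Vec ℕ k) → InX N k x → f x ≡ true →
         IsPareto N k f (searchParetoPoint k f x) × searchParetoPoint k f x ≤ₖ x
lemma1 N k _ f feasible x x∈X fx =
  all-tight-pareto admissible (λ j → processed-tight j (∈-allFin j)) , proj₂ admissible
  where
  open Descent feasible x∈X
  admissible : Admissible (searchParetoPoint k f x)
  admissible = proj₁ (processAll-spec (allFin k) x (fx , ≤ₖ-refl {x = x}))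
  processed-tight : ∀ j → j ∈ allFin k → Tight (searchParetoPoint k f x) j
  processed-tight = proj₂ (proj₂ (processAll-spec (allFin k) x (fx , ≤ₖ-refl {x = x})))
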